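{- Let $u,v$ be rational functions with $u(n)>0$ for all integers $n\ge 2$, and let $\{a_n\}_{n\geq 0}$ be a sequence of positive real numbers satisfying $a_n=u(n)a_{n-1}+v(n)a_{n-2}$ for $n\ge 2$. Assume $v(n)<0$ for all $n\geq 2$. If there exist a nonnegative integer $N$ and a function $h$ such that for all $n\geq N+2$: (i) $3u(n)/4\leq a_n/a_{n-1}\leq h(n)$; and (ii) $h(n)^4-u(n)h(n)^3-u(n+1)v(n)h(n)-v(n)v(n+1)< 0$, then the sequence $\{a_n\}_{n\geq N}$ is ratio log-concave.
   Context: A sequence $(x_n)_{n\ge m}$ of positive reals is log-concave if $x_n^2\ge x_{n-1}x_{n+1}$ for all $n\ge m+1$. A sequence $(a_n)_{n\ge m}$ of positive reals is ratio log-concave if $(a_{n+1}/a_n)_{n\ge m}$ is log-concave. -}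

module Defs where

open import Data.Nat as ℕ using (ℕ; zero; suc)
open import Data.List using (List; []; _∷_)
open import Data.Product using (Σ; _×_; _,_)
open import Data.Sum using (_⊎_)
open import Relation.Nullary using (¬_)
open import Relation.Binary.PropositionalEquality using (_≡_)

-- The real numbers, axiomatised as a complete ordered field (unique up to
-- isomorphism).  Equality is propositional; the
-- multiplicative inverse is total with the (unconstrained) value at 0
-- irrelevant, as only x ≢ 0 → x * x ⁻¹ ≡ 1 is assumed.
record RealField : Set₁ where
  infixl 6 _+_
  infixl 7 _*_
  infix  8 -_
  infix  9 _⁻¹
  infix  4 _<_ _≤_
  field
    Carrier : Set
    0# 1#   : Carrier
    _+_ _*_ : Carrier → Carrier → Carrier
    -_      : Carrier → Carrier
    _⁻¹     : Carrier → Carrier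
    _<_     : Carrier → Carrier → Set
    +-assoc    : ∀ x y z → (x + y) + z ≡ x + (y + z)
    +-comm     : ∀ x y → x + y ≡ y + x
    +-identityˡ : ∀ x → 0# + x ≡ x
    -‿inverseˡ : ∀ x → (- x) + x ≡ 0#
    *-assoc    : ∀ x y z → (x * y) * z ≡ x * (y * z)
    *-comm     : ∀ x y → x * y ≡ y * x
    *-identityˡ : ∀ x → 1# * x ≡ x
    distribˡ   : ∀ x y z → x * (y + z) ≡ x * y + x * z
    0≢1        : ¬ (0# ≡ 1#)
    ⁻¹-inverse : ∀ x → ¬ (x ≡ 0#) → x * x ⁻¹ ≡ 1#
    <-irrefl   : ∀ x → ¬ (x < x)
    <-trans    : ∀ {x y z} → x < y → y < z → x < z
    <-trichotomy : ∀ x y → (x < y) ⊎ ((x ≡ y) ⊎ (y < x))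
    +-mono-<   : ∀ {x y} z → x < y → x + z < y + z
    *-pos      : ∀ {x y} → 0# < x → 0# < y → 0# < x * y
  _≤_ : Carrier → Carrier → Set
  x ≤ y = (x < y) ⊎ (x ≡ y)
  field
    lub : (P : Carrier → Set) → Σ Carrier P → Σ Carrier (λ b → ∀ x → P x → x ≤ b) →
          Σ Carrier (λ s → (∀ x → P x → x ≤ s) ×
                           (∀ b → (∀ x → P x → x ≤ b) → s ≤ b))

module RealNotation (R : RealField) where
  open RealField R

  infixl 6 _-_
  infixl 7 _÷_
  infixr 8 _^_

  _-_ : Carrier → Carrier → Carrier
  x - y = x + (- y)

  _÷_ : Carrier → Carrier → Carrier
  x ÷ y = x * y ⁻¹

  _^_ : Carrier → ℕ → Carrier
  x ^ zero  = 1#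
  x ^ suc n = x * (x ^ n)

  fromℕ : ℕ → Carrier
  fromℕ zero    = 0#
  fromℕ (suc n) = 1# + fromℕ n

  -- real polynomials as coefficient lists c₀ ∷ c₁ ∷ …, evaluated (Horner) at a real
  Poly : Set
  Poly = List Carrier

  evalPoly : Poly → Carrier → Carrier
  evalPoly []       x = 0#
  evalPoly (c ∷ cs) x = c + x * evalPoly cs x

  record RatFun : Set where
    constructor _/ₚ_
    field
      num den : Poly

  evalRat : RatFun → ℕ → Carrier
  evalRat (p /ₚ q) n = evalPoly p (fromℕ n) ÷ evalPoly q (fromℕ n)

  LogConcaveFrom : ℕ → (ℕ → Carrier) → Set
  LogConcaveFrom m x =
    (∀ n → m ℕ.≤ n → 0# < x n) ×
    (∀ n → suc m ℕ.≤ n → x (ℕ.pred n) * x (suc n) ≤ x n ^ 2)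

  RatioLogConcaveFrom : ℕ → (ℕ → Carrier) → Set
  RatioLogConcaveFrom m a =
    (∀ n → m ℕ.≤ n → 0# < a n) ×
    LogConcaveFrom m (λ n → a (suc n) ÷ a n)

module Submission where

-- Write y, x, z for the consecutive ratios a(n-1)/a(n-2), a(n)/a(n-1), a(n+1)/a(n).  The
-- recurrence gives x y = u(n) y + v(n) and z x = u(n+1) x + v(n+1), hence
-- (x - u(n)) x (x² - y z) = F(x) with F the quartic of condition (ii) at n.  As
-- y (x - u(n)) = v(n) < 0, the factor (x - u(n)) x is negative, so F(x) < 0 gives x² > y z.
-- Finally 3 (F(h) - F(x)) = (h - x) G with G > 0 whenever 3u(n)/4 ≤ x ≤ h, so F(h(n)) < 0
-- forces F(x) < 0.

open import Defs
open import Data.Nat as ℕ using (ℕ; zero; suc; _∸_; s≤s; z≤n)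
open import Data.Integer as ℤ using (ℤ; -[1+_])
import Data.Integer.Properties as ℤP
import Data.Nat.Properties as ℕP
open import Data.Sign as Sign using (Sign)
open import Data.Product using (_×_; _,_; proj₁; proj₂)
open import Data.Sum using (inj₁; inj₂)
open import Data.Empty using (⊥-elim)
open import Data.Maybe using (Maybe; just; nothing)
open import Relation.Nullary using (yes; no; ¬_)
open import Relation.Binary.PropositionalEquality
open import Algebra.Bundles using (CommutativeRing)
open import Algebra.Structures using (IsCommutativeRing)
open import Algebra.Solver.Ring.AlmostCommutativeRing
  using (fromCommutativeRing; _-Raw-AlmostCommutative⟶_)

module RealFieldRing (R : RealField) where
  open RealField R
  open RealNotation R
  open import Algebra.Consequences.Propositional {A = Carrier}

  isCommutativeRing : IsCommutativeRing _≡_ _+_ _*_ -_ 0# 1#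
  isCommutativeRing = record
    { isRing = record
      { +-isAbelianGroup = record
        { isGroup = record
          { isMonoid = record
            { isSemigroup = record
              { isMagma = record { isEquivalence = isEquivalence ; ∙-cong = cong₂ _+_ }
              ; assoc = +-assoc }
            ; identity = comm∧idˡ⇒id +-comm +-identityˡ }
          ; inverse = comm∧invˡ⇒inv +-comm -‿inverseˡ
          ; ⁻¹-cong = cong (-_) }
        ; comm = +-comm }
      ; *-cong = cong₂ _*_
      ; *-assoc = *-assoc
      ; *-identity = comm∧idˡ⇒id *-comm *-identityˡ
      ; distrib = distribˡ , comm∧distrˡ⇒distrʳ *-comm distribˡ }
    ; *-comm = *-comm }

  commutativeRing : CommutativeRing _ _
  commutativeRing = record { isCommutativeRing = isCommutativeRing }

  open CommutativeRing commutativeRing public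
    using (+-identityʳ; *-identityʳ; zeroˡ; zeroʳ; -‿inverseʳ)
  open CommutativeRing commutativeRing using (semiring; ring; +-group; +-abelianGroup; +-commutativeSemigroup)
  open import Algebra.Properties.Ring ring public using (-‿distribˡ-*)
  open import Algebra.Properties.Group +-group using (ε⁻¹≈ε; ⁻¹-involutive)
  open import Algebra.Properties.AbelianGroup +-abelianGroup using (⁻¹-∙-comm)
  open import Algebra.Properties.CommutativeSemigroup +-commutativeSemigroup using (interchange)
  open import Algebra.Properties.Semiring.Mult semiring using (×-homo-+; ×1-homo-*) renaming (_×_ to _×ᵤ_)

  private
    ⟦_⟧ℤ : ℤ → Carrier
    ⟦ ℤ.+ n ⟧ℤ    = fromℕ n
    ⟦ -[1+ n ] ⟧ℤ = - fromℕ (suc n)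

    fromℕ≡×1 : ∀ n → fromℕ n ≡ n ×ᵤ 1#
    fromℕ≡×1 zero    = refl
    fromℕ≡×1 (suc n) = cong (1# +_) (fromℕ≡×1 n)

    fromℕ-+ : ∀ m n → fromℕ (m ℕ.+ n) ≡ fromℕ m + fromℕ n
    fromℕ-+ m n = trans (fromℕ≡×1 (m ℕ.+ n))
      (trans (×-homo-+ 1# m n) (sym (cong₂ _+_ (fromℕ≡×1 m) (fromℕ≡×1 n))))

    fromℕ-* : ∀ m n → fromℕ (m ℕ.* n) ≡ fromℕ m * fromℕ n
    fromℕ-* m n = trans (fromℕ≡×1 (m ℕ.* n))
      (trans (×1-homo-* m n) (sym (cong₂ _*_ (fromℕ≡×1 m) (fromℕ≡×1 n))))

    1+x-[1+y]≡x-y : ∀ x y → (1# + x) - (1# + y) ≡ x - y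
    1+x-[1+y]≡x-y x y = begin
      (1# + x) + - (1# + y)    ≡⟨ cong ((1# + x) +_) (⁻¹-∙-comm 1# y) ⟨
      (1# + x) + (- 1# + - y)  ≡⟨ interchange 1# x (- 1#) (- y) ⟩
      (1# - 1#) + (x - y)      ≡⟨ cong (_+ (x - y)) (-‿inverseʳ 1#) ⟩
      0# + (x - y)             ≡⟨ +-identityˡ (x - y) ⟩
      x - y                    ∎
      where open ≡-Reasoning

    ⟦⊖⟧ : ∀ m n → ⟦ m ℤ.⊖ n ⟧ℤ ≡ fromℕ m - fromℕ n
    ⟦⊖⟧ m       zero    = trans (sym (+-identityʳ (fromℕ m))) (cong (fromℕ m +_) (sym ε⁻¹≈ε))
    ⟦⊖⟧ zero    (suc n) = sym (+-identityˡ _)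
    ⟦⊖⟧ (suc m) (suc n) = trans (cong ⟦_⟧ℤ (ℤP.[1+m]⊖[1+n]≡m⊖n m n))
                                (trans (⟦⊖⟧ m n) (sym (1+x-[1+y]≡x-y (fromℕ m) (fromℕ n))))

    ⟦+⟧ : ∀ i j → ⟦ i ℤ.+ j ⟧ℤ ≡ ⟦ i ⟧ℤ + ⟦ j ⟧ℤ
    ⟦+⟧ (ℤ.+ m)  (ℤ.+ n)  = fromℕ-+ m n
    ⟦+⟧ (ℤ.+ m)  -[1+ n ] = ⟦⊖⟧ m (suc n)
    ⟦+⟧ -[1+ m ] (ℤ.+ n)  = trans (⟦⊖⟧ n (suc m)) (+-comm _ _)
    ⟦+⟧ -[1+ m ] -[1+ n ] = begin
      - fromℕ (suc (suc (m ℕ.+ n)))     ≡⟨ cong (λ k → - fromℕ (suc k)) (ℕP.+-suc m n) ⟨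
      - fromℕ (suc m ℕ.+ suc n)         ≡⟨ cong (-_) (fromℕ-+ (suc m) (suc n)) ⟩
      - (fromℕ (suc m) + fromℕ (suc n)) ≡⟨ ⁻¹-∙-comm _ _ ⟨
      ⟦ -[1+ m ] ⟧ℤ + ⟦ -[1+ n ] ⟧ℤ     ∎
      where open ≡-Reasoning

    sign : Sign → Carrier
    sign Sign.+ = 1#
    sign Sign.- = - 1#

    sign-* : ∀ s t → sign (s Sign.* t) ≡ sign s * sign t
    sign-* Sign.+ t      = sym (*-identityˡ _)
    sign-* Sign.- Sign.+ = sym (*-identityʳ _)
    sign-* Sign.- Sign.- = sym (trans (sym (-‿distribˡ-* 1# (- 1#)))
                                      (trans (cong (-_) (*-identityˡ _)) (⁻¹-involutive 1#)))

    ⟦◃⟧ : ∀ s n → ⟦ s ℤ.◃ n ⟧ℤ ≡ sign s * fromℕ n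
    ⟦◃⟧ s       zero    = sym (zeroʳ _)
    ⟦◃⟧ Sign.+ (suc n) = sym (*-identityˡ _)
    ⟦◃⟧ Sign.- (suc n) = trans (cong (-_) (sym (*-identityˡ _))) (-‿distribˡ-* 1# _)

    ⟦⟧ℤ-sign-abs : ∀ i → ⟦ i ⟧ℤ ≡ sign (ℤ.sign i) * fromℕ ℤ.∣ i ∣
    ⟦⟧ℤ-sign-abs i = trans (cong ⟦_⟧ℤ (sym (ℤP.◃-inverse i))) (⟦◃⟧ (ℤ.sign i) ℤ.∣ i ∣)

    ⟦*⟧ : ∀ i j → ⟦ i ℤ.* j ⟧ℤ ≡ ⟦ i ⟧ℤ * ⟦ j ⟧ℤ
    ⟦*⟧ i j = begin
      ⟦ i ℤ.* j ⟧ℤ                             ≡⟨ ⟦◃⟧ (s Sign.* t) (m ℕ.* n) ⟩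
      sign (s Sign.* t) * fromℕ (m ℕ.* n)      ≡⟨ cong₂ _*_ (sign-* s t) (fromℕ-* m n) ⟩
      (sign s * sign t) * (fromℕ m * fromℕ n)  ≡⟨ interchange* (sign s) (sign t) _ _ ⟩
      (sign s * fromℕ m) * (sign t * fromℕ n)  ≡⟨ cong₂ _*_ (⟦⟧ℤ-sign-abs i) (⟦⟧ℤ-sign-abs j) ⟨
      ⟦ i ⟧ℤ * ⟦ j ⟧ℤ                          ∎
      where
      open ≡-Reasoning
      open import Algebra.Properties.CommutativeSemigroup
        (CommutativeRing.*-commutativeSemigroup commutativeRing) renaming (interchange to interchange*)
      s t : Sign
      s = ℤ.sign i
      t = ℤ.sign j
      m n : ℕ
      m = ℤ.∣ i ∣
      n = ℤ.∣ j ∣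

    ⟦-⟧ : ∀ i → ⟦ ℤ.- i ⟧ℤ ≡ - ⟦ i ⟧ℤ
    ⟦-⟧ -[1+ n ]    = sym (⁻¹-involutive _)
    ⟦-⟧ (ℤ.+ zero)  = sym ε⁻¹≈ε
    ⟦-⟧ (ℤ.+ suc n) = refl

    ℤ-embedding : ℤ.+-*-rawRing -Raw-AlmostCommutative⟶ fromCommutativeRing commutativeRing
    ℤ-embedding = record
      { ⟦_⟧ = ⟦_⟧ℤ ; +-homo = ⟦+⟧ ; *-homo = ⟦*⟧ ; -‿homo = ⟦-⟧
      ; 0-homo = refl ; 1-homo = +-identityʳ 1# }

    ⟦⟧ℤ-≟ : ∀ i j → Maybe (⟦ i ⟧ℤ ≡ ⟦ j ⟧ℤ)
    ⟦⟧ℤ-≟ i j with i ℤ.≟ j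
    ... | yes refl = just refl
    ... | no _     = nothing

  open import Algebra.Solver.Ring ℤ.+-*-rawRing (fromCommutativeRing commutativeRing) ℤ-embedding ⟦⟧ℤ-≟ public
    using (solve; _:+_; _:*_; _:-_; :-_; _:^_; con; _:=_)

  -x*-y≡x*y : ∀ x y → (- x) * (- y) ≡ x * y
  -x*-y≡x*y = solve 2 (λ x y → (:- x) :* (:- y) := x :* y) refl

module RealFieldOrder (R : RealField) where
  open RealField R
  open RealNotation R
  open RealFieldRing R

  <-asym : ∀ {x y} → x < y → ¬ (y < x)
  <-asym x<y y<x = <-irrefl _ (<-trans x<y y<x)

  x<y⇒0<y-x : ∀ {x y} → x < y → 0# < y - x
  x<y⇒0<y-x {x} {y} x<y = subst (_< y - x) (-‿inverseʳ x) (+-mono-< (- x) x<y)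

  0<y-x⇒x<y : ∀ {x y} → 0# < y - x → x < y
  0<y-x⇒x<y {x} {y} 0<y-x = subst₂ _<_ (+-identityˡ x) (y-x+x≡y x y) (+-mono-< x 0<y-x)
    where
    y-x+x≡y : ∀ x y → y - x + x ≡ y
    y-x+x≡y = solve 2 (λ x y → y :- x :+ x := y) refl

  x≤y⇒0≤y-x : ∀ {x y} → x ≤ y → 0# ≤ y - x
  x≤y⇒0≤y-x (inj₁ x<y)  = inj₁ (x<y⇒0<y-x x<y)
  x≤y⇒0≤y-x (inj₂ refl) = inj₂ (sym (-‿inverseʳ _))

  x<0⇒0<-x : ∀ {x} → x < 0# → 0# < - x
  x<0⇒0<-x {x} x<0 = subst (0# <_) (+-identityˡ (- x)) (x<y⇒0<y-x x<0)

  0<-x⇒x<0 : ∀ {x} → 0# < - x → x < 0#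
  0<-x⇒x<0 {x} 0<-x = subst₂ _<_ (+-identityˡ x) (-‿inverseˡ x) (+-mono-< x 0<-x)

  ≤-<-trans : ∀ {x y z} → x ≤ y → y < z → x < z
  ≤-<-trans (inj₁ x<y)  y<z = <-trans x<y y<z
  ≤-<-trans (inj₂ refl) y<z = y<z

  <-≤-trans : ∀ {x y z} → x < y → y ≤ z → x < z
  <-≤-trans x<y (inj₁ y<z)  = <-trans x<y y<z
  <-≤-trans x<y (inj₂ refl) = x<y

  x≤x+y : ∀ x {y} → 0# ≤ y → x ≤ x + y
  x≤x+y x (inj₁ 0<y)  = inj₁ (subst₂ _<_ (+-identityˡ x) (+-comm _ _) (+-mono-< x 0<y))
  x≤x+y x (inj₂ refl) = inj₂ (sym (+-identityʳ x))

  +-pos : ∀ {x y} → 0# < x → 0# < y → 0# < x + y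
  +-pos {x} {y} 0<x 0<y = <-trans 0<y (subst (_< x + y) (+-identityˡ y) (+-mono-< y 0<x))

  +-nonneg-pos : ∀ {x y} → 0# ≤ x → 0# < y → 0# < x + y
  +-nonneg-pos (inj₁ 0<x)  0<y = +-pos 0<x 0<y
  +-nonneg-pos (inj₂ refl) 0<y = subst (0# <_) (sym (+-identityˡ _)) 0<y

  +-nonneg : ∀ {x y} → 0# ≤ x → 0# ≤ y → 0# ≤ x + y
  +-nonneg 0≤x (inj₁ 0<y)  = inj₁ (+-nonneg-pos 0≤x 0<y)
  +-nonneg 0≤x (inj₂ refl) = subst (0# ≤_) (sym (+-identityʳ _)) 0≤x

  *-nonneg : ∀ {x y} → 0# ≤ x → 0# ≤ y → 0# ≤ x * y
  *-nonneg (inj₁ 0<x)  (inj₁ 0<y)  = inj₁ (*-pos 0<x 0<y)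
  *-nonneg _           (inj₂ refl) = inj₂ (sym (zeroʳ _))
  *-nonneg (inj₂ refl) _           = inj₂ (sym (zeroˡ _))

  *-neg-pos : ∀ {x y} → x < 0# → 0# < y → x * y < 0#
  *-neg-pos {x} {y} x<0 0<y =
    0<-x⇒x<0 (subst (0# <_) (sym (-‿distribˡ-* x y)) (*-pos (x<0⇒0<-x x<0) 0<y))

  *-pos-neg : ∀ {x y} → 0# < x → y < 0# → x * y < 0#
  *-pos-neg {x} {y} 0<x y<0 = subst (_< 0#) (*-comm y x) (*-neg-pos y<0 0<x)

  pos*x<0⇒x<0 : ∀ {c x} → 0# < c → c * x < 0# → x < 0#
  pos*x<0⇒x<0 {c} {x} 0<c cx<0 with <-trichotomy x 0#
  ... | inj₁ x<0         = x<0
  ... | inj₂ (inj₁ refl) = ⊥-elim (<-irrefl 0# (subst (_< 0#) (zeroʳ c) cx<0))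
  ... | inj₂ (inj₂ 0<x)  = ⊥-elim (<-asym cx<0 (*-pos 0<c 0<x))

  neg*x<0⇒0<x : ∀ {c x} → c < 0# → c * x < 0# → 0# < x
  neg*x<0⇒0<x {c} {x} c<0 cx<0 with <-trichotomy x 0#
  ... | inj₁ x<0         = ⊥-elim (<-asym cx<0
                             (subst (0# <_) (-x*-y≡x*y c x) (*-pos (x<0⇒0<-x c<0) (x<0⇒0<-x x<0))))
  ... | inj₂ (inj₁ refl) = ⊥-elim (<-irrefl 0# (subst (_< 0#) (zeroʳ c) cx<0))
  ... | inj₂ (inj₂ 0<x)  = 0<x

  0<x⇒x≢0 : ∀ {x} → 0# < x → x ≢ 0#
  0<x⇒x≢0 0<x refl = <-irrefl 0# 0<x

  0<1 : 0# < 1#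
  0<1 with <-trichotomy 0# 1#
  ... | inj₁ 0<1         = 0<1
  ... | inj₂ (inj₁ 0≡1)  = ⊥-elim (0≢1 0≡1)
  ... | inj₂ (inj₂ 1<0)  = ⊥-elim (<-asym 1<0
                             (subst (0# <_) (trans (-x*-y≡x*y 1# 1#) (*-identityˡ 1#))
                               (*-pos (x<0⇒0<-x 1<0) (x<0⇒0<-x 1<0))))

  0<fromℕ-suc : ∀ n → 0# < fromℕ (suc n)
  0<fromℕ-suc zero    = subst (0# <_) (sym (+-identityʳ 1#)) 0<1
  0<fromℕ-suc (suc n) = +-pos 0<1 (0<fromℕ-suc n)

  0<x⇒0<x⁻¹ : ∀ {x} → 0# < x → 0# < x ⁻¹
  0<x⇒0<x⁻¹ {x} 0<x with <-trichotomy (x ⁻¹) 0#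
  ... | inj₁ x⁻¹<0         = ⊥-elim (<-asym 0<1
                               (subst (_< 0#) (⁻¹-inverse x (0<x⇒x≢0 0<x)) (*-pos-neg 0<x x⁻¹<0)))
  ... | inj₂ (inj₁ x⁻¹≡0)  = ⊥-elim (0≢1 (begin
      0#         ≡⟨ zeroʳ x ⟨
      x * 0#     ≡⟨ cong (x *_) x⁻¹≡0 ⟨
      x * x ⁻¹   ≡⟨ ⁻¹-inverse x (0<x⇒x≢0 0<x) ⟩
      1#         ∎))
    where open ≡-Reasoning
  ... | inj₂ (inj₂ 0<x⁻¹) = 0<x⁻¹

module RatioLogConcavity (R : RealField) where
  open RealField R
  open RealNotation R
  open RealFieldRing R
  open RealFieldOrder R

  quartic : (u v u′ v′ t : Carrier) → Carrier
  quartic u v u′ v′ t = t ^ 4 - u * t ^ 3 - u′ * v * t - v * v′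

  ratio-recurrence : ∀ {p q r} u v → p ≢ 0# → q ≢ 0# → r ≡ u * q + v * p →
                     (r ÷ q) * (q ÷ p) ≡ u * (q ÷ p) + v
  ratio-recurrence {p} {q} {r} u v p≢0 q≢0 r≡uq+vp = begin
    (r ÷ q) * (q ÷ p)                            ≡⟨ cong (λ t → (t ÷ q) * (q ÷ p)) r≡uq+vp ⟩
    ((u * q + v * p) ÷ q) * (q ÷ p)              ≡⟨ regroup u v p q (p ⁻¹) (q ⁻¹) ⟩
    (u * (q ÷ p) + v * (p * p ⁻¹)) * (q * q ⁻¹)  ≡⟨ cong₂ (λ a b → (u * (q ÷ p) + v * a) * b)
                                                          (⁻¹-inverse p p≢0) (⁻¹-inverse q q≢0) ⟩
    (u * (q ÷ p) + v * 1#) * 1#                  ≡⟨ *-identityʳ _ ⟩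
    u * (q ÷ p) + v * 1#                         ≡⟨ cong (u * (q ÷ p) +_) (*-identityʳ v) ⟩
    u * (q ÷ p) + v                              ∎
    where
    open ≡-Reasoning
    regroup : ∀ u v p q p′ q′ →
              ((u * q + v * p) * q′) * (q * p′) ≡ (u * (q * p′) + v * (p * p′)) * (q * q′)
    regroup = solve 6 (λ u v p q p′ q′ →
      ((u :* q :+ v :* p) :* q′) :* (q :* p′) := (u :* (q :* p′) :+ v :* (p :* p′)) :* (q :* q′)) refl

  ratio-defect≡quartic : ∀ {u v u′ v′ x y z} → x * y ≡ u * y + v → z * x ≡ u′ * x + v′ →
                         (x - u) * x * (x ^ 2 - y * z) ≡ quartic u v u′ v′ x
  ratio-defect≡quartic {u} {v} {u′} {v′} {x} {y} {z} xy≡uy+v zx≡u′x+v′ = begin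
    (x - u) * x * (x ^ 2 - y * z)                             ≡⟨ expand u x y z ⟩
    x ^ 4 - u * x ^ 3 - (x * y - u * y) * (z * x)             ≡⟨ cong₂ (λ a b → x ^ 4 - u * x ^ 3 - (a - u * y) * b)
                                                                       xy≡uy+v zx≡u′x+v′ ⟩
    x ^ 4 - u * x ^ 3 - (u * y + v - u * y) * (u′ * x + v′)   ≡⟨ collect u v u′ v′ x y ⟩
    quartic u v u′ v′ x                                       ∎
    where
    open ≡-Reasoning
    expand : ∀ u x y z → (x - u) * x * (x ^ 2 - y * z) ≡ x ^ 4 - u * x ^ 3 - (x * y - u * y) * (z * x)
    expand = solve 4 (λ u x y z →
      (x :- u) :* x :* (x :^ 2 :- y :* z) := x :^ 4 :- u :* x :^ 3 :- (x :* y :- u :* y) :* (z :* x)) refl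
    collect : ∀ u v u′ v′ x y →
              x ^ 4 - u * x ^ 3 - (u * y + v - u * y) * (u′ * x + v′) ≡ quartic u v u′ v′ x
    collect = solve 6 (λ u v u′ v′ x y →
      x :^ 4 :- u :* x :^ 3 :- (u :* y :+ v :- u :* y) :* (u′ :* x :+ v′)
        := x :^ 4 :- u :* x :^ 3 :- u′ :* v :* x :- v :* v′) refl

  -- Three times the slope of the secant of `quartic` through x and h, arranged so that
  -- every summand is visibly nonnegative once 3u/4 ≤ x ≤ h, u′ > 0 and v < 0.
  secant : (u v u′ h x : Carrier) → Carrier
  secant u v u′ h x = (fromℕ 4 * x - fromℕ 3 * u) * (h * h + h * x + x * x)
                    + (h - x) * (fromℕ 3 * (h * h) + fromℕ 2 * (h * x) + x * x)
                    + fromℕ 3 * (u′ * (- v))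

  quartic-secant : ∀ u v u′ v′ h x →
                   fromℕ 3 * quartic u v u′ v′ x + (h - x) * secant u v u′ h x ≡ fromℕ 3 * quartic u v u′ v′ h
  quartic-secant = solve 6 (λ u v u′ v′ h x →
    con (ℤ.+ 3) :* (x :^ 4 :- u :* x :^ 3 :- u′ :* v :* x :- v :* v′)
      :+ (h :- x) :* ((con (ℤ.+ 4) :* x :- con (ℤ.+ 3) :* u) :* (h :* h :+ h :* x :+ x :* x)
                      :+ (h :- x) :* (con (ℤ.+ 3) :* (h :* h) :+ con (ℤ.+ 2) :* (h :* x) :+ x :* x)
                      :+ con (ℤ.+ 3) :* (u′ :* (:- v)))
      := con (ℤ.+ 3) :* (h :^ 4 :- u :* h :^ 3 :- u′ :* v :* h :- v :* v′)) refl

  three-quarters-bound : ∀ {u x} → fromℕ 3 ÷ fromℕ 4 * u ≤ x → 0# ≤ fromℕ 4 * x - fromℕ 3 * u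
  three-quarters-bound {u} {x} 3u/4≤x =
    subst (0# ≤_) scale (*-nonneg (inj₁ (0<fromℕ-suc 3)) (x≤y⇒0≤y-x 3u/4≤x))
    where
    open ≡-Reasoning
    distribute : ∀ u x i → fromℕ 4 * (x - fromℕ 3 * i * u) ≡ fromℕ 4 * x - fromℕ 4 * i * fromℕ 3 * u
    distribute = solve 3 (λ u x i →
      con (ℤ.+ 4) :* (x :- con (ℤ.+ 3) :* i :* u)
        := con (ℤ.+ 4) :* x :- con (ℤ.+ 4) :* i :* con (ℤ.+ 3) :* u) refl
    scale : fromℕ 4 * (x - fromℕ 3 ÷ fromℕ 4 * u) ≡ fromℕ 4 * x - fromℕ 3 * u
    scale = begin
      fromℕ 4 * (x - fromℕ 3 ÷ fromℕ 4 * u)              ≡⟨ distribute u x (fromℕ 4 ⁻¹) ⟩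
      fromℕ 4 * x - fromℕ 4 ÷ fromℕ 4 * fromℕ 3 * u      ≡⟨ cong (λ c → fromℕ 4 * x - c * fromℕ 3 * u)
                                                                 (⁻¹-inverse _ (0<x⇒x≢0 (0<fromℕ-suc 3))) ⟩
      fromℕ 4 * x - 1# * fromℕ 3 * u                     ≡⟨ cong (λ c → fromℕ 4 * x - c * u) (*-identityˡ _) ⟩
      fromℕ 4 * x - fromℕ 3 * u                          ∎

  secant-pos : ∀ {u v u′ h x} → 0# < x → 0# ≤ fromℕ 4 * x - fromℕ 3 * u → x ≤ h → 0# < u′ → v < 0# →
               0# < secant u v u′ h x
  secant-pos {u} {v} {u′} {h} {x} 0<x 0≤4x-3u x≤h 0<u′ v<0 =
    +-nonneg-pos (+-nonneg (*-nonneg 0≤4x-3u (inj₁ 0<h²+hx+x²))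
                           (*-nonneg (x≤y⇒0≤y-x x≤h) (inj₁ 0<3h²+2hx+x²)))
                 (*-pos (0<fromℕ-suc 2) (*-pos 0<u′ (x<0⇒0<-x v<0)))
    where
    0<h : 0# < h
    0<h = <-≤-trans 0<x x≤h
    0<h²+hx+x² : 0# < h * h + h * x + x * x
    0<h²+hx+x² = +-pos (+-pos (*-pos 0<h 0<h) (*-pos 0<h 0<x)) (*-pos 0<x 0<x)
    0<3h²+2hx+x² : 0# < fromℕ 3 * (h * h) + fromℕ 2 * (h * x) + x * x
    0<3h²+2hx+x² = +-pos (+-pos (*-pos (0<fromℕ-suc 2) (*-pos 0<h 0<h)) (*-pos (0<fromℕ-suc 1) (*-pos 0<h 0<x)))
                         (*-pos 0<x 0<x)

  quartic<0-below : ∀ {u v u′ v′ h x} → 0# < x → fromℕ 3 ÷ fromℕ 4 * u ≤ x → x ≤ h → 0# < u′ → v < 0# →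
                    quartic u v u′ v′ h < 0# → quartic u v u′ v′ x < 0#
  quartic<0-below {u} {v} {u′} {v′} {h} {x} 0<x 3u/4≤x x≤h 0<u′ v<0 Fh<0 =
    pos*x<0⇒x<0 0<3 (≤-<-trans (x≤x+y _ 0≤[h-x]secant) 3Fx+[h-x]secant<0)
    where
    0<3 : 0# < fromℕ 3
    0<3 = 0<fromℕ-suc 2
    0≤[h-x]secant : 0# ≤ (h - x) * secant u v u′ h x
    0≤[h-x]secant = *-nonneg (x≤y⇒0≤y-x x≤h)
                             (inj₁ (secant-pos 0<x (three-quarters-bound 3u/4≤x) x≤h 0<u′ v<0))
    3Fx+[h-x]secant<0 : fromℕ 3 * quartic u v u′ v′ x + (h - x) * secant u v u′ h x < 0#
    3Fx+[h-x]secant<0 = subst (_< 0#) (sym (quartic-secant u v u′ v′ h x)) (*-pos-neg 0<3 Fh<0)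

  ratio-log-concave : ∀ {p q r s u v u′ v′} → 0# < p → 0# < q → 0# < r → v < 0# →
                      r ≡ u * q + v * p → s ≡ u′ * r + v′ * q → quartic u v u′ v′ (r ÷ q) < 0# →
                      (q ÷ p) * (s ÷ r) ≤ (r ÷ q) ^ 2
  ratio-log-concave {p} {q} {r} {s} {u} {v} {u′} {v′} 0<p 0<q 0<r v<0 r≡ s≡ Fx<0 =
    inj₁ (0<y-x⇒x<y (neg*x<0⇒0<x (*-neg-pos x-u<0 0<x) (subst (_< 0#) (sym defect) Fx<0)))
    where
    open ≡-Reasoning
    x y z : Carrier
    x = r ÷ q
    y = q ÷ p
    z = s ÷ r
    0<x : 0# < x
    0<x = *-pos 0<r (0<x⇒0<x⁻¹ 0<q)
    xy≡uy+v : x * y ≡ u * y + v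
    xy≡uy+v = ratio-recurrence u v (0<x⇒x≢0 0<p) (0<x⇒x≢0 0<q) r≡
    defect : (x - u) * x * (x ^ 2 - y * z) ≡ quartic u v u′ v′ x
    defect = ratio-defect≡quartic xy≡uy+v (ratio-recurrence u′ v′ (0<x⇒x≢0 0<q) (0<x⇒x≢0 0<r) s≡)
    y[x-u]≡v : y * (x - u) ≡ v
    y[x-u]≡v = begin
      y * (x - u)         ≡⟨ solve 3 (λ u x y → y :* (x :- u) := x :* y :- u :* y) refl u x y ⟩
      x * y - u * y       ≡⟨ cong (_- u * y) xy≡uy+v ⟩
      u * y + v - u * y   ≡⟨ solve 3 (λ u v y → u :* y :+ v :- u :* y := v) refl u v y ⟩
      v                   ∎
    x-u<0 : x - u < 0#
    x-u<0 = pos*x<0⇒x<0 (*-pos 0<q (0<x⇒0<x⁻¹ 0<p)) (subst (_< 0#) (sym y[x-u]≡v) v<0)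

theorem4p5 : (R : RealField) → let open RealField R in let open RealNotation R in
    (u v : RatFun) →
    (∀ n → 2 ℕ.≤ n → 0# < evalRat u n) →
    (a : ℕ → Carrier) →
    (∀ n → 0# < a n) →
    (∀ n → 2 ℕ.≤ n → a n ≡ evalRat u n * a (n ∸ 1) + evalRat v n * a (n ∸ 2)) →
    (∀ n → 2 ℕ.≤ n → evalRat v n < 0#) →
    (N : ℕ) → (h : ℕ → Carrier) →
    (∀ n → N ℕ.+ 2 ℕ.≤ n →
      (fromℕ 3 ÷ fromℕ 4 * evalRat u n ≤ a n ÷ a (n ∸ 1)) ×
      (a n ÷ a (n ∸ 1) ≤ h n)) →
    (∀ n → N ℕ.+ 2 ℕ.≤ n →
      h n ^ 4 - evalRat u n * h n ^ 3 - evalRat u (suc n) * evalRat v n * h n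
        - evalRat v n * evalRat v (suc n) < 0#) →
    RatioLogConcaveFrom N a
theorem4p5 R u v 0<u a 0<a recurrence v<0 N h ratio-bounds quartic-h<0 =
  (λ n _ → 0<a n) , (λ n _ → 0<ratio n) , log-concave
  where
  open RealField R
  open RealNotation R
  open RealFieldOrder R
  open RatioLogConcavity R

  0<ratio : ∀ n → 0# < a (suc n) ÷ a n
  0<ratio n = *-pos (0<a (suc n)) (0<x⇒0<x⁻¹ (0<a n))

  log-concave : ∀ n → suc N ℕ.≤ n →
                (a (suc (ℕ.pred n)) ÷ a (ℕ.pred n)) * (a (suc (suc n)) ÷ a (suc n)) ≤ (a (suc n) ÷ a n) ^ 2
  log-concave (suc k) (s≤s N≤k) =
    ratio-log-concave (0<a k) (0<a (suc k)) (0<a n) (v<0 n 2≤n) (recurrence n 2≤n) (recurrence (suc n) 2≤1+n)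
      (quartic<0-below (0<ratio (suc k)) (proj₁ (ratio-bounds n N+2≤n)) (proj₂ (ratio-bounds n N+2≤n))
                       (0<u (suc n) 2≤1+n) (v<0 n 2≤n) (quartic-h<0 n N+2≤n))
    where
    n : ℕ
    n = 2 ℕ.+ k
    2≤n : 2 ℕ.≤ n
    2≤n = s≤s (s≤s z≤n)
    2≤1+n : 2 ℕ.≤ suc n
    2≤1+n = s≤s (s≤s z≤n)
    N+2≤n : N ℕ.+ 2 ℕ.≤ n
    N+2≤n = ℕP.≤-trans (ℕP.≤-reflexive (ℕP.+-comm N 2)) (s≤s (s≤s N≤k))
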